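{- Let $n,d>1$ be integers such that $g = dn/2$ is an integer. Then \[ r(\mathrm{GL}(g)_{\mathbb{Q}(i)}, 2) \geq r(\mathrm{GL}(n)_\mathbb{Q}, 2) + r(S_d, 2), \] with equality only for $(n,d) = (2,2)$.
   Context: For a (smooth linear) group scheme $G$ of finite type over a number field $F$, choose a model over $\mathfrak{o}_F[1/N]$ for some positive integer $N$, so that $G(\mathbb{F}_{\mathfrak{q}})$, $\mathbb{F}_{\mathfrak{q}} = \mathfrak{o}_F/\mathfrak{q}$, makes sense for all but finitely many prime ideals $\mathfrak{q}$ of $\mathfrak{o}_F$. The nonnegative integers $r(G,p)$ are defined by $\prod_p p^{r(G,p)} = \sup_S \{\gcd_{\mathfrak{q} \in S} \#G(\mathbb{F}_{\mathfrak{q}})\}$, where $S$ runs over all cofinite sets of prime ideals of $\mathfrak{o}_F$. The symmetric group $S_d$ is regarded as a constant finite group scheme over $\mathbb{Q}$, so $r(S_d,2)$ is the $2$-adic valuation of $d!$. -}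

module Defs where

open import Data.Nat using (ℕ; zero; suc; _+_; _*_; _∸_; _^_; _≤_; _%_)
open import Data.Nat.Divisibility using (_∣_)
open import Data.Nat.Primality using (Prime)
open import Data.Product using (Σ; _×_)
open import Relation.Nullary using (¬_)

prodBelow : ℕ → (ℕ → ℕ) → ℕ
prodBelow zero    f = 1
prodBelow (suc m) f = prodBelow m f * f m

glOrder : ℕ → ℕ → ℕ
glOrder m q = prodBelow m (λ k → q ^ m ∸ q ^ k)

-- Size of the residue field(s) of Z[i] above the rational prime ℓ:
-- ℓ if ℓ ≡ 1 mod 4 (split) or ℓ = 2 (ramified), ℓ^2 if ℓ ≡ 3 mod 4 (inert).
normQiAux : ℕ → ℕ → ℕ
normQiAux ℓ 3 = ℓ * ℓ
normQiAux ℓ _ = ℓ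

normQi : ℕ → ℕ
normQi ℓ = normQiAux ℓ (ℓ % 4)

-- p^r divides f ℓ for all rational primes ℓ outside a finite set
-- (i.e. for all primes ℓ ≥ B for some bound B).  Here f ℓ is #G(F_𝔮) for
-- the prime ideals 𝔮 above ℓ (all of which have the same residue field size
-- in the cases used here).
EventuallyDiv : (ℕ → ℕ) → ℕ → ℕ → Set
EventuallyDiv f p r = Σ ℕ λ B → ∀ ℓ → Prime ℓ → B ≤ ℓ → p ^ r ∣ f ℓ

-- r is the exponent r(G,p): the largest r with p^r dividing
-- sup_S gcd_{𝔮∈S} #G(F_𝔮), S cofinite.
IsR : (ℕ → ℕ) → ℕ → ℕ → Set
IsR f p r = EventuallyDiv f p r × ¬ EventuallyDiv f p (suc r)

-- #GL(m, F_q) = q ^ (m (m - 1) / 2) * ∏_{j=1}^{m} (q ^ j - 1), and lifting the exponent gives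
-- v₂ (q ^ j - 1) ≥ 2 + v₂ j for q ≡ 1 (mod 4), while for odd q it is at least 1 (j odd) resp.
-- 2 + v₂ j (j even), with equality for q ≡ 5 resp. q ≡ 3 (mod 8). The residue fields of ℤ[i] at
-- odd primes have size ≡ 1 (mod 4), and there are arbitrarily large primes ≡ 5 and ≡ 3 (mod 8):
-- take a prime factor ≢ 1 (mod 8) of X² + 4 resp. X² + 2, where X is the product of all small
-- odd numbers; -4 resp. -2 is a non-residue modulo the remaining odd primes (Euler's criterion and
-- Gauss's lemma). Hence r(GL(g)_ℚ(i), 2) = 2 g + v₂ (g !), r(GL(n)_ℚ, 2) = 2 n + v₂ (n !) - ⌈n/2⌉
-- and r(S_d, 2) = v₂ (d !). For d = 2 (so g = n) the two sides differ by ⌈n/2⌉ - 1; for d ≥ 3 the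
-- inequality is strict because v₂ (n !) ≤ n, v₂ (d !) ≤ v₂ (g !) and 2 g = d n ≥ 3 n.

{-# OPTIONS --safe #-}
module Submission where

open import Defs
open import Data.Nat
open import Data.Nat.Properties
open import Data.Nat.Divisibility
open import Data.Nat.DivMod using (m%n<n; [m+kn]%n≡m%n; m*n%n≡0; m/n*n≡m; m≡m%n+[m/n]*n; %-distribˡ-*)
open import Data.Nat.Induction using (<-rec)
open import Data.Nat.Primality using (Prime; euclidsLemma; prime⇒nonTrivial; prime⇒irreducible)
open import Data.Nat.Primality.Factorisation using (PrimeFactorisation; factorise)
open import Data.Nat.ListAction using (product)
open import Data.List.Base using ([]; _∷_)
open import Data.List.Relation.Unary.All using (All; []; _∷_)
open import Data.Nat.Combinatorics using (_C_; nCn≡1; nCk≡n!/k![n-k]!; k![n∸k]!∣n!)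
open import Data.Fin.Base using (zero; suc; toℕ; fromℕ; inject₁)
open import Data.Fin.Properties using (toℕ-fromℕ; toℕ-inject₁; toℕ<n)
open import Data.Vec.Functional using (Vector)
import Algebra.Properties.CommutativeSemiring.Binomial +-*-commutativeSemiring as Binomial
open import Algebra.Properties.Monoid.Sum +-0-monoid using (sum; sum-init-last)
import Algebra.Definitions.RawMonoid +-0-rawMonoid as Additive
import Algebra.Definitions.RawSemiring +-*-rawSemiring as Semiring
open import Data.Nat.Tactic.RingSolver using (solve-∀)
open import Data.Product using (Σ; ∃; ∃-syntax; _×_; _,_; proj₁; proj₂)
open import Data.Sum using (_⊎_; inj₁; inj₂; [_,_]′)
open import Data.Empty using (⊥-elim)
open import Relation.Nullary using (¬_; yes; no)
open import Relation.Binary.Definitions using (tri<; tri≈; tri>)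
open import Relation.Binary.PropositionalEquality
open import Relation.Binary.Bundles using (Setoid)
open import Relation.Binary.Structures using (IsEquivalence)
open import Data.Integer.Base as ℤ using (ℤ; +_; 1ℤ; -1ℤ; 0ℤ)
import Data.Integer.Properties as ℤₚ
import Data.Integer.Divisibility.Signed as ℤ∣
open import Data.Integer.Tactic.RingSolver using () renaming (solve-∀ to ℤ-solve-∀)
import Relation.Binary.Reasoning.Setoid as SetoidReasoning

private variable
  c e e′ k m n p q r s x y : ℕ
  i i′ j j′ : ℤ

sumBelow : ℕ → (ℕ → ℕ) → ℕ
sumBelow zero    f = 0
sumBelow (suc m) f = sumBelow m f + f m

module _ {f g : ℕ → ℕ} where

  sumBelow-cong : ∀ m → (∀ k → k < m → f k ≡ g k) → sumBelow m f ≡ sumBelow m g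
  sumBelow-cong zero    f≡g = refl
  sumBelow-cong (suc m) f≡g =
    cong₂ _+_ (sumBelow-cong m λ k k<m → f≡g k (m<n⇒m<1+n k<m)) (f≡g m ≤-refl)

  sumBelow-distrib-+ : ∀ m → sumBelow m (λ k → f k + g k) ≡ sumBelow m f + sumBelow m g
  sumBelow-distrib-+ zero    = refl
  sumBelow-distrib-+ (suc m) rewrite sumBelow-distrib-+ m =
    +-assoc-comm (sumBelow m f) (sumBelow m g) (f m) (g m)
    where
    +-assoc-comm : ∀ a b c d → a + b + (c + d) ≡ a + c + (b + d)
    +-assoc-comm = solve-∀

sumBelow-const : ∀ m c → sumBelow m (λ _ → c) ≡ m * c
sumBelow-const zero    c = refl
sumBelow-const (suc m) c rewrite sumBelow-const m c = +-comm (m * c) c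

sumBelow-monoˡ-≤ : ∀ (f : ℕ → ℕ) → m ≤ n → sumBelow m f ≤ sumBelow n f
sumBelow-monoˡ-≤ {n = zero}  f z≤n = z≤n
sumBelow-monoˡ-≤ {n = suc n} f m≤1+n with m≤n⇒m<n∨m≡n m≤1+n
... | inj₁ m<1+n = ≤-trans (sumBelow-monoˡ-≤ f (≤-pred m<1+n)) (m≤m+n _ _)
... | inj₂ refl  = ≤-refl

sumBelow-shift : ∀ m (f : ℕ → ℕ) → sumBelow (suc m) f ≡ f 0 + sumBelow m (λ k → f (suc k))
sumBelow-shift zero    f = +-comm 0 (f 0)
sumBelow-shift (suc m) f rewrite sumBelow-shift m f =
  +-assoc (f 0) (sumBelow m (λ k → f (suc k))) (f (suc m))

sumBelow-reverse : ∀ m (f : ℕ → ℕ) → sumBelow m (λ k → f (m ∸ k)) ≡ sumBelow m (λ k → f (suc k))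
sumBelow-reverse zero    f = refl
sumBelow-reverse (suc m) f = begin
  sumBelow m (λ k → f (suc m ∸ k)) + f (suc m ∸ m)
    ≡⟨ cong₂ _+_ (sumBelow-cong m λ k k<m → cong f (+-∸-assoc 1 (<⇒≤ k<m)))
                 (cong f (+-∸-assoc 1 (≤-refl {m}))) ⟩
  sumBelow m (λ k → f (suc (m ∸ k))) + f (suc (m ∸ m))
    ≡⟨ cong₂ _+_ (sumBelow-reverse m (λ i → f (suc i))) (cong (λ i → f (suc i)) (n∸n≡0 m)) ⟩
  sumBelow m (λ k → f (suc (suc k))) + f 1
    ≡⟨ +-comm _ (f 1) ⟩
  f 1 + sumBelow m (λ k → f (suc (suc k)))
    ≡⟨ sumBelow-shift m (λ i → f (suc i)) ⟨
  sumBelow (suc m) (λ k → f (suc k)) ∎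
  where open ≡-Reasoning

∣prodBelow : ∀ (f : ℕ → ℕ) → k < m → f k ∣ prodBelow m f
∣prodBelow {m = suc m} f k<1+m with m≤n⇒m<n∨m≡n (≤-pred k<1+m)
... | inj₁ k<m = ∣m⇒∣m*n (f m) (∣prodBelow f k<m)
... | inj₂ refl = n∣m*n (prodBelow m f)

-- Parity and the 2-adic valuation

even-or-odd : ∀ n → (∃[ k ] n ≡ 2 * k) ⊎ (∃[ k ] n ≡ suc (2 * k))
even-or-odd zero = inj₁ (0 , refl)
even-or-odd (suc n) with even-or-odd n
... | inj₁ (k , n≡2k)   = inj₂ (k , cong suc n≡2k)
... | inj₂ (k , n≡1+2k) = inj₁ (suc k , trans (cong suc n≡1+2k) (sym (*-suc 2 k)))

1+2a≢2b : ∀ a b → suc (2 * a) ≢ 2 * b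
1+2a≢2b a b eq = 1≢0 (begin
  1                             ≡⟨ [m+kn]%n≡m%n 1 a 2 ⟨
  (1 + a * 2) % 2               ≡⟨ cong (_% 2) (trans (cong suc (*-comm a 2)) eq) ⟩
  (2 * b) % 2                   ≡⟨ cong (_% 2) (*-comm 2 b) ⟩
  (b * 2) % 2                   ≡⟨ m*n%n≡0 b 2 ⟩
  0                             ∎)
  where
  open ≡-Reasoning
  1≢0 : 1 ≢ 0
  1≢0 ()

^-monoʳ-∣ : ∀ a → m ≤ n → a ^ m ∣ a ^ n
^-monoʳ-∣ {m} {n} a m≤n = divides (a ^ (n ∸ m)) (begin
  a ^ n                ≡⟨ cong (a ^_) (m+[n∸m]≡n m≤n) ⟨
  a ^ (m + (n ∸ m))    ≡⟨ ^-distribˡ-+-* a m (n ∸ m) ⟩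
  a ^ m * a ^ (n ∸ m)  ≡⟨ *-comm (a ^ m) _ ⟩
  a ^ (n ∸ m) * a ^ m  ∎)
  where open ≡-Reasoning

infix 4 2^_*_≈_ 2^_∥_

record 2^_*_≈_ (w u y : ℕ) : Set where
  constructor _,_
  field
    half-excess : ℕ
    factorisation : y ≡ 2 ^ w * (u + 2 * half-excess)

2^_∥_ : ℕ → ℕ → Set
2^ e ∥ y = 2^ e * 1 ≈ y

≈⇒∣ : ∀ {w u} → 2^ w * u ≈ y → 2 ^ w ∣ y
≈⇒∣ {w = w} {u} (V , y≡) = divides (u + 2 * V) (trans y≡ (*-comm (2 ^ w) _))

≈-odd⇒∥ : ∀ {w} t → 2^ w * suc (2 * t) ≈ y → 2^ w ∥ y
≈-odd⇒∥ {w = w} t (V , y≡) = t + V , trans y≡ (cong (λ z → 2 ^ w * suc z) (sym (*-distribˡ-+ 2 t V)))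

∥⇒∣ : 2^ e ∥ y → 2 ^ e ∣ y
∥⇒∣ = ≈⇒∣

∥⇒∤ : 2^ e ∥ y → ¬ 2 ^ suc e ∣ y
∥⇒∤ {e} {y} (u , y≡) (divides v y≡v*2^[1+e]) = 1+2a≢2b u v (*-cancelˡ-≡ _ _ (2 ^ e) {{m^n≢0 2 e}} (begin
  2 ^ e * suc (2 * u)  ≡⟨ y≡ ⟨
  y                    ≡⟨ y≡v*2^[1+e] ⟩
  v * (2 * 2 ^ e)      ≡⟨ swap v (2 ^ e) ⟩
  2 ^ e * (2 * v)      ∎))
  where
  open ≡-Reasoning
  swap : ∀ v P → v * (2 * P) ≡ P * (2 * v)
  swap = solve-∀

∥-unique : 2^ e ∥ y → 2^ e′ ∥ y → e ≡ e′
∥-unique {e} {y} {e′} e∥y e′∥y with <-cmp e e′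
... | tri< e<e′ _ _ = ⊥-elim (∥⇒∤ e∥y (∣-trans (^-monoʳ-∣ 2 e<e′) (∥⇒∣ e′∥y)))
... | tri≈ _ e≡e′ _ = e≡e′
... | tri> _ _ e′<e = ⊥-elim (∥⇒∤ e′∥y (∣-trans (^-monoʳ-∣ 2 e′<e) (∥⇒∣ e∥y)))

∥-* : ∀ {a b} → 2^ a ∥ x → 2^ b ∥ y → 2^ (a + b) ∥ x * y
∥-* {x} {y} {a} {b} (u , x≡) (v , y≡) = u + v + 2 * u * v , (begin
  x * y                                                   ≡⟨ cong₂ _*_ x≡ y≡ ⟩
  2 ^ a * suc (2 * u) * (2 ^ b * suc (2 * v))             ≡⟨ regroup (2 ^ a) (2 ^ b) u v ⟩
  2 ^ a * 2 ^ b * suc (2 * (u + v + 2 * u * v))           ≡⟨ cong (_* _) (^-distribˡ-+-* 2 a b) ⟨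
  2 ^ (a + b) * suc (2 * (u + v + 2 * u * v))             ∎)
  where
  open ≡-Reasoning
  regroup : ∀ A B u v → A * suc (2 * u) * (B * suc (2 * v)) ≡ A * B * suc (2 * (u + v + 2 * u * v))
  regroup = solve-∀

module _ {f w : ℕ → ℕ} where

  prodBelow-∥ : ∀ m → (∀ k → k < m → 2^ w k ∥ f k) → 2^ sumBelow m w ∥ prodBelow m f
  prodBelow-∥ zero    _    = 0 , refl
  prodBelow-∥ (suc m) w∥f = ∥-* (prodBelow-∥ m λ k k<m → w∥f k (m<n⇒m<1+n k<m)) (w∥f m ≤-refl)

  prodBelow-∣ : ∀ m → (∀ k → k < m → 2 ^ w k ∣ f k) → 2 ^ sumBelow m w ∣ prodBelow m f
  prodBelow-∣ zero    _    = ∣-refl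
  prodBelow-∣ (suc m) w∣f = subst (_∣ prodBelow (suc m) f) (sym (^-distribˡ-+-* 2 (sumBelow m w) (w m)))
    (*-pres-∣ (prodBelow-∣ m λ k k<m → w∣f k (m<n⇒m<1+n k<m)) (w∣f m ≤-refl))

2-adic-decomposition : ∀ n → ∃[ e ] 2^ e ∥ suc n
2-adic-decomposition = <-rec (λ n → ∃[ e ] 2^ e ∥ suc n) step
  where
  step : ∀ n → (∀ {m} → m < n → ∃[ e ] 2^ e ∥ suc m) → ∃[ e ] 2^ e ∥ suc n
  step n rec with even-or-odd (suc n)
  ... | inj₂ (k , 1+n≡1+2k)     = 0 , k , trans 1+n≡1+2k (sym (+-identityʳ _))
  ... | inj₁ (suc k , 1+n≡2[1+k]) with rec (subst (k <_) (sym (suc-injective 1+n≡2[1+k])) (m<m+n k z<s))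
  ...   | e , u , 1+k≡ = suc e , u , (begin
    suc n                        ≡⟨ 1+n≡2[1+k] ⟩
    2 * suc k                    ≡⟨ cong (2 *_) 1+k≡ ⟩
    2 * (2 ^ e * suc (2 * u))    ≡⟨ *-assoc 2 (2 ^ e) _ ⟨
    2 ^ suc e * suc (2 * u)      ∎)
    where open ≡-Reasoning

-- Junk value: v₂ 0 = 0.
v₂ : ℕ → ℕ
v₂ zero    = 0
v₂ (suc n) = proj₁ (2-adic-decomposition n)

2^v₂∥ : ∀ n .{{_ : NonZero n}} → 2^ v₂ n ∥ n
2^v₂∥ (suc n) = proj₂ (2-adic-decomposition n)

∥⇒v₂≡ : 2^ e ∥ n → v₂ n ≡ e
∥⇒v₂≡ {e} {zero} (u , 0≡) = ⊥-elim (≢-nonZero⁻¹ _ {{m*n≢0 (2 ^ e) (suc (2 * u)) {{m^n≢0 2 e}}}} (sym 0≡))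
∥⇒v₂≡ {e} {suc n} e∥n = ∥-unique (2^v₂∥ (suc n)) e∥n

v₂[1+2k]≡0 : ∀ k → v₂ (suc (2 * k)) ≡ 0
v₂[1+2k]≡0 k = ∥⇒v₂≡ (k , sym (+-identityʳ _))

v₂[2n]≡1+v₂[n] : ∀ n .{{_ : NonZero n}} → v₂ (2 * n) ≡ suc (v₂ n)
v₂[2n]≡1+v₂[n] n = ∥⇒v₂≡ (∥-* {a = 1} (0 , refl) (2^v₂∥ n))

-- Lifting the exponent

[1+2ms]^[1+2k] : ∀ m s k → ∃[ V ] (1 + 2 * m * s) ^ suc (2 * k) ≡ 1 + 2 * m * (s + 2 * V)
[1+2ms]^[1+2k] m s zero    = 0 , base m s
  where
  base : ∀ m s → (1 + 2 * m * s) * 1 ≡ 1 + 2 * m * (s + 2 * 0)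
  base = solve-∀
[1+2ms]^[1+2k] m s (suc k) with [1+2ms]^[1+2k] m s k
... | V , zᵏ≡ = V + (s + m * s * s) + 2 * m * (s + 2 * V) * (s + m * s * s) , (begin
  z ^ suc (2 * suc k)                   ≡⟨ cong (z ^_) (exponent k) ⟩
  z ^ (suc (2 * k) + 2)                 ≡⟨ ^-distribˡ-+-* z (suc (2 * k)) 2 ⟩
  z ^ suc (2 * k) * z ^ 2               ≡⟨ cong (_* z ^ 2) zᵏ≡ ⟩
  (1 + 2 * m * (s + 2 * V)) * z ^ 2     ≡⟨ step m s V ⟩
  1 + 2 * m * (s + 2 * (V + (s + m * s * s) + 2 * m * (s + 2 * V) * (s + m * s * s))) ∎)
  where
  open ≡-Reasoning
  z = 1 + 2 * m * s
  exponent : ∀ k → suc (2 * suc k) ≡ suc (2 * k) + 2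
  exponent = solve-∀
  step : ∀ m s V → (1 + 2 * m * (s + 2 * V)) * ((1 + 2 * m * s) * ((1 + 2 * m * s) * 1))
       ≡ 1 + 2 * m * (s + 2 * (V + (s + m * s * s) + 2 * m * (s + 2 * V) * (s + m * s * s)))
  step = solve-∀

[1+2^[2+c]u]^2^e : ∀ c e u → ∃[ V ] (1 + 2 ^ (2 + c) * u) ^ (2 ^ e) ≡ 1 + 2 ^ (2 + c + e) * (u + 2 * V)
[1+2^[2+c]u]^2^e c zero    u = 0 , (begin
  (1 + 2 ^ (2 + c) * u) * 1          ≡⟨ base (2 ^ (2 + c)) u ⟩
  1 + 2 ^ (2 + c) * (u + 2 * 0)      ≡⟨ cong (λ i → 1 + 2 ^ i * (u + 2 * 0)) (+-identityʳ (2 + c)) ⟨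
  1 + 2 ^ (2 + c + 0) * (u + 2 * 0)  ∎)
  where
  open ≡-Reasoning
  base : ∀ P u → (1 + P * u) * 1 ≡ 1 + P * (u + 2 * 0)
  base = solve-∀
[1+2^[2+c]u]^2^e c (suc e) u with [1+2^[2+c]u]^2^e c e u
... | V , z^2^e≡ = V + Q * (u + 2 * V) * (u + 2 * V) , (begin
  z ^ (2 ^ suc e)                                      ≡⟨ cong (z ^_) (*-comm 2 (2 ^ e)) ⟩
  z ^ (2 ^ e * 2)                                      ≡⟨ ^-*-assoc z (2 ^ e) 2 ⟨
  (z ^ (2 ^ e)) ^ 2                                    ≡⟨ cong (_^ 2) z^2^e≡ ⟩
  (1 + 2 * (2 * Q) * (u + 2 * V)) ^ 2                  ≡⟨ square Q u V ⟩
  1 + 2 * (2 * (2 * Q)) * (u + 2 * (V + Q * (u + 2 * V) * (u + 2 * V)))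
    ≡⟨ cong (λ i → 1 + 2 ^ i * (u + 2 * (V + Q * (u + 2 * V) * (u + 2 * V)))) (+-suc (2 + c) e) ⟨
  1 + 2 ^ (2 + c + suc e) * (u + 2 * (V + Q * (u + 2 * V) * (u + 2 * V))) ∎)
  where
  open ≡-Reasoning
  z = 1 + 2 ^ (2 + c) * u
  Q = 2 ^ (c + e)
  square : ∀ Q u V → (1 + 2 * (2 * Q) * (u + 2 * V)) * ((1 + 2 * (2 * Q) * (u + 2 * V)) * 1)
         ≡ 1 + 2 * (2 * (2 * Q)) * (u + 2 * (V + Q * (u + 2 * V) * (u + 2 * V)))
  square = solve-∀

-- Write j = 2 ^ v₂ j * (odd): odd powers keep q mod 2 ^ (3 + c), and each squaring adds a factor 2.
2^[2+c+v₂j]*s≈q^j∸1 : ∀ c → q ≡ 1 + 2 ^ (2 + c) * s →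
                      ∀ j .{{_ : NonZero j}} → 2^ (2 + c + v₂ j) * s ≈ q ^ j ∸ 1
2^[2+c+v₂j]*s≈q^j∸1 {q} {s} c q≡ j with 2^v₂∥ j
... | o , j≡ with [1+2ms]^[1+2k] (2 ^ suc c) s o
...   | W , qᵒ≡ with [1+2^[2+c]u]^2^e c (v₂ j) (s + 2 * W)
...     | V , qʲ≡ = W + V , (begin
  q ^ j ∸ 1                                          ≡⟨ cong (λ i → q ^ i ∸ 1) (trans j≡ (*-comm (2 ^ v₂ j) _)) ⟩
  q ^ (suc (2 * o) * 2 ^ v₂ j) ∸ 1                   ≡⟨ cong (_∸ 1) (^-*-assoc q (suc (2 * o)) (2 ^ v₂ j)) ⟨
  (q ^ suc (2 * o)) ^ (2 ^ v₂ j) ∸ 1                 ≡⟨ cong (λ x → (x ^ suc (2 * o)) ^ (2 ^ v₂ j) ∸ 1) q≡ ⟩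
  ((1 + 2 ^ (2 + c) * s) ^ suc (2 * o)) ^ (2 ^ v₂ j) ∸ 1 ≡⟨ cong (λ x → x ^ (2 ^ v₂ j) ∸ 1) qᵒ≡ ⟩
  (1 + 2 ^ (2 + c) * (s + 2 * W)) ^ (2 ^ v₂ j) ∸ 1    ≡⟨ cong (_∸ 1) qʲ≡ ⟩
  2 ^ (2 + c + v₂ j) * (s + 2 * W + 2 * V)           ≡⟨ cong (2 ^ (2 + c + v₂ j) *_) (regroup s W V) ⟩
  2 ^ (2 + c + v₂ j) * (s + 2 * (W + V))             ∎)
  where
  open ≡-Reasoning
  regroup : ∀ s W V → s + 2 * W + 2 * V ≡ s + 2 * (W + V)
  regroup = solve-∀

-- Closed forms of v₂ (q ^ j ∸ 1), j ≥ 1, for q ≡ 5 resp. q ≡ 3 (mod 8); for q ≡ 1 (mod 4)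
-- resp. q odd they are lower bounds.
v₂[5^j∸1] : ℕ → ℕ
v₂[5^j∸1] j = 2 + v₂ j

v₂[3^j∸1] : ℕ → ℕ
v₂[3^j∸1] j = v₂[5^j∸1] j ∸ j % 2

[1+2k]%2≡1 : ∀ k → suc (2 * k) % 2 ≡ 1
[1+2k]%2≡1 k = trans (cong (λ i → suc i % 2) (*-comm 2 k)) ([m+kn]%n≡m%n 1 k 2)

[2k]%2≡0 : ∀ k → (2 * k) % 2 ≡ 0
[2k]%2≡0 k = trans (cong (_% 2) (*-comm 2 k)) (m*n%n≡0 k 2)

v₂[3^j∸1][1+2k]≡1 : ∀ k → v₂[3^j∸1] (suc (2 * k)) ≡ 1
v₂[3^j∸1][1+2k]≡1 k = cong₂ (λ v r → 2 + v ∸ r) (v₂[1+2k]≡0 k) ([1+2k]%2≡1 k)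

v₂[3^j∸1][2i]≡3+v₂[i] : ∀ i .{{_ : NonZero i}} → v₂[3^j∸1] (2 * i) ≡ 3 + v₂ i
v₂[3^j∸1][2i]≡3+v₂[i] i = cong₂ (λ v r → 2 + v ∸ r) (v₂[2n]≡1+v₂[n] i) ([2k]%2≡0 i)

v₂[5^j∸1]≡v₂[3^j∸1]+j%2 : ∀ j → v₂[5^j∸1] j ≡ v₂[3^j∸1] j + j % 2
v₂[5^j∸1]≡v₂[3^j∸1]+j%2 j = sym (m∸n+n≡m (≤-trans (<⇒≤ (m%n<n j 2)) (m≤m+n 2 (v₂ j))))

2^v₂[5^j∸1]≈q^j∸1 : q ≡ 1 + 4 * s → ∀ j .{{_ : NonZero j}} → 2^ v₂[5^j∸1] j * s ≈ q ^ j ∸ 1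
2^v₂[5^j∸1]≈q^j∸1 = 2^[2+c+v₂j]*s≈q^j∸1 0

2^v₂[3^j∸1]≈q^[1+2k]∸1 : q ≡ 1 + 2 * s → ∀ k → 2^ v₂[3^j∸1] (suc (2 * k)) * s ≈ q ^ suc (2 * k) ∸ 1
2^v₂[3^j∸1]≈q^[1+2k]∸1 {q} {s} q≡ k with [1+2ms]^[1+2k] 1 s k
... | V , qʲ≡ = V , (begin
  q ^ suc (2 * k) ∸ 1                           ≡⟨ cong (λ z → z ^ suc (2 * k) ∸ 1) q≡ ⟩
  (1 + 2 * s) ^ suc (2 * k) ∸ 1                 ≡⟨ cong (_∸ 1) qʲ≡ ⟩
  2 * (s + 2 * V)                               ≡⟨ cong (λ w → 2 ^ w * (s + 2 * V)) (v₂[3^j∸1][1+2k]≡1 k) ⟨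
  2 ^ v₂[3^j∸1] (suc (2 * k)) * (s + 2 * V)     ∎)
  where open ≡-Reasoning

2^v₂[3^j∸1]≈q^[2i]∸1 : ∀ {T} → q * q ≡ 1 + 8 * T → ∀ i .{{_ : NonZero i}} →
                        2^ v₂[3^j∸1] (2 * i) * T ≈ q ^ (2 * i) ∸ 1
2^v₂[3^j∸1]≈q^[2i]∸1 {q} {T} q²≡ i with 2^[2+c+v₂j]*s≈q^j∸1 {s = T} 1 q²≡ i
... | V , q²ⁱ≡ = V , (begin
  q ^ (2 * i) ∸ 1                               ≡⟨ cong (_∸ 1) (^-*-assoc q 2 i) ⟨
  (q ^ 2) ^ i ∸ 1                               ≡⟨ cong (λ z → (q * z) ^ i ∸ 1) (*-identityʳ q) ⟩
  (q * q) ^ i ∸ 1                               ≡⟨ q²ⁱ≡ ⟩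
  2 ^ (3 + v₂ i) * (T + 2 * V)                  ≡⟨ cong (λ w → 2 ^ w * (T + 2 * V)) (v₂[3^j∸1][2i]≡3+v₂[i] i) ⟨
  2 ^ v₂[3^j∸1] (2 * i) * (T + 2 * V)           ∎)
  where open ≡-Reasoning

2^v₂[3^j∸1]≈q^j∸1 : ∀ {T} → q ≡ 1 + 2 * s → q * q ≡ 1 + 8 * T → ∀ j .{{_ : NonZero j}} →
                     2^ v₂[3^j∸1] j * s ≈ q ^ j ∸ 1 ⊎ 2^ v₂[3^j∸1] j * T ≈ q ^ j ∸ 1
2^v₂[3^j∸1]≈q^j∸1 {q} q≡ q²≡ j with even-or-odd j
... | inj₂ (k , refl)     = inj₁ (2^v₂[3^j∸1]≈q^[1+2k]∸1 q≡ k)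
... | inj₁ (suc i , refl) = inj₂ (2^v₂[3^j∸1]≈q^[2i]∸1 {q} q²≡ (suc i))

-- Orders of general linear groups

q^m∸q^k≡q^k*[q^[m∸k]∸1] : ∀ q → k ≤ m → q ^ m ∸ q ^ k ≡ q ^ k * (q ^ (m ∸ k) ∸ 1)
q^m∸q^k≡q^k*[q^[m∸k]∸1] {k} {m} q k≤m = begin
  q ^ m ∸ q ^ k                        ≡⟨ cong (λ i → q ^ i ∸ q ^ k) (m+[n∸m]≡n k≤m) ⟨
  q ^ (k + (m ∸ k)) ∸ q ^ k            ≡⟨ cong₂ _∸_ (^-distribˡ-+-* q k (m ∸ k)) (sym (*-identityʳ (q ^ k))) ⟩
  q ^ k * q ^ (m ∸ k) ∸ q ^ k * 1      ≡⟨ *-distribˡ-∸ (q ^ k) (q ^ (m ∸ k)) 1 ⟨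
  q ^ k * (q ^ (m ∸ k) ∸ 1)            ∎
  where open ≡-Reasoning

2^0∥q^k : q ≡ 1 + 2 * s → ∀ k → 2^ 0 ∥ q ^ k
2^0∥q^k         q≡ zero    = 0 , refl
2^0∥q^k {q} {s} q≡ (suc k) = ∥-* (s , trans q≡ (sym (*-identityˡ _))) (2^0∥q^k {s = s} q≡ k)

glExponent : (ℕ → ℕ) → ℕ → ℕ
glExponent w m = sumBelow m (λ k → w (suc k))

module _ {q : ℕ} {w : ℕ → ℕ} where

  private
    glExponent-reversed : ∀ m → glExponent w m ≡ sumBelow m (λ k → w (m ∸ k))
    glExponent-reversed m = sym (sumBelow-reverse m w)

    m∸k≢0 : ∀ {m k} → k < m → NonZero (m ∸ k)
    m∸k≢0 k<m = ≢-nonZero (m>n⇒m∸n≢0 k<m)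

  2^glExponent∣glOrder : (∀ j .{{_ : NonZero j}} → 2 ^ w j ∣ q ^ j ∸ 1) →
                         ∀ m → 2 ^ glExponent w m ∣ glOrder m q
  2^glExponent∣glOrder 2^w∣ m = subst (λ e → 2 ^ e ∣ glOrder m q) (sym (glExponent-reversed m))
    (prodBelow-∣ m λ k k<m → subst (2 ^ w (m ∸ k) ∣_) (sym (q^m∸q^k≡q^k*[q^[m∸k]∸1] q (<⇒≤ k<m)))
      (∣n⇒∣m*n (q ^ k) (2^w∣ (m ∸ k) {{m∸k≢0 k<m}})))

  2^glExponent∥glOrder : q ≡ 1 + 2 * s → (∀ j .{{_ : NonZero j}} → 2^ w j ∥ q ^ j ∸ 1) →
                         ∀ m → 2^ glExponent w m ∥ glOrder m q
  2^glExponent∥glOrder {s} q≡ 2^w∥ m = subst (λ e → 2^ e ∥ glOrder m q) (sym (glExponent-reversed m))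
    (prodBelow-∥ m λ k k<m → subst (2^ w (m ∸ k) ∥_) (sym (q^m∸q^k≡q^k*[q^[m∸k]∸1] q (<⇒≤ k<m)))
      (∥-* (2^0∥q^k {s = s} q≡ k) (2^w∥ (m ∸ k) {{m∸k≢0 k<m}})))

oddProduct : ℕ → ℕ
oddProduct m = prodBelow m (λ k → suc (2 * k))

2^0∥oddProduct : ∀ m → 2^ 0 ∥ oddProduct m
2^0∥oddProduct zero    = 0 , refl
2^0∥oddProduct (suc m) = ∥-* (2^0∥oddProduct m) (m , sym (+-identityʳ _))

[2r]!≡2^r*r!*oddProduct : ∀ r → (2 * r) ! ≡ 2 ^ r * r ! * oddProduct r
                              × suc (2 * r) ! ≡ 2 ^ r * r ! * oddProduct (suc r)
[2r]!≡2^r*r!*oddProduct zero    = refl , refl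
[2r]!≡2^r*r!*oddProduct (suc r) = even , odd
  where
  open ≡-Reasoning
  A = 2 ^ r
  F = r !
  O = oddProduct (suc r)
  even : (2 * suc r) ! ≡ 2 ^ suc r * suc r ! * O
  even = begin
    (2 * suc r) !                     ≡⟨ cong _! (*-suc 2 r) ⟩
    (2 + 2 * r) * suc (2 * r) !       ≡⟨ cong ((2 + 2 * r) *_) (proj₂ ([2r]!≡2^r*r!*oddProduct r)) ⟩
    (2 + 2 * r) * (A * F * O)         ≡⟨ regroup r A F O ⟩
    2 * A * (suc r * F) * O           ∎
    where
    regroup : ∀ r A F O → (2 + 2 * r) * (A * F * O) ≡ 2 * A * ((1 + r) * F) * O
    regroup = solve-∀
  odd : suc (2 * suc r) ! ≡ 2 ^ suc r * suc r ! * oddProduct (suc (suc r))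
  odd = begin
    suc (2 * suc r) * (2 * suc r) !                       ≡⟨ cong (suc (2 * suc r) *_) even ⟩
    suc (2 * suc r) * (2 ^ suc r * suc r ! * O)           ≡⟨ regroup (suc (2 * suc r)) (2 ^ suc r * suc r !) O ⟩
    2 ^ suc r * suc r ! * (O * suc (2 * suc r))           ∎
    where
    regroup : ∀ a b c → a * (b * c) ≡ b * (c * a)
    regroup = solve-∀

v₂[2^r*r!*oddProduct] : ∀ r m → v₂ (2 ^ r * r ! * oddProduct m) ≡ r + v₂ (r !)
v₂[2^r*r!*oddProduct] r m = ∥⇒v₂≡ (subst (λ e → 2^ e ∥ 2 ^ r * r ! * oddProduct m) (+-identityʳ _)
  (∥-* (∥-* (0 , sym (*-identityʳ (2 ^ r))) (2^v₂∥ (r !) {{r !≢0}})) (2^0∥oddProduct m)))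

v₂[n!]≤n : ∀ n → v₂ (n !) ≤ n
v₂[n!]≤n = <-rec (λ n → v₂ (n !) ≤ n) bound
  where
  bound : ∀ n → (∀ {m} → m < n → v₂ (m !) ≤ m) → v₂ (n !) ≤ n
  bound n rec with even-or-odd n
  ... | inj₁ (zero , refl) = ≤-reflexive (∥⇒v₂≡ (0 , refl))
  ... | inj₁ (suc r , refl) = begin
    v₂ ((2 * suc r) !)                                  ≡⟨ cong v₂ (proj₁ ([2r]!≡2^r*r!*oddProduct (suc r))) ⟩
    v₂ (2 ^ suc r * suc r ! * oddProduct (suc r))       ≡⟨ v₂[2^r*r!*oddProduct] (suc r) (suc r) ⟩
    suc r + v₂ (suc r !)                                ≤⟨ +-monoʳ-≤ (suc r) (rec (m<m+n (suc r) z<s)) ⟩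
    suc r + suc r                                       ≡⟨ cong (λ z → suc r + z) (+-identityʳ (suc r)) ⟨
    2 * suc r                                           ∎
    where open ≤-Reasoning
  ... | inj₂ (r , refl) = begin
    v₂ (suc (2 * r) !)                                  ≡⟨ cong v₂ (proj₂ ([2r]!≡2^r*r!*oddProduct r)) ⟩
    v₂ (2 ^ r * r ! * oddProduct (suc r))               ≡⟨ v₂[2^r*r!*oddProduct] r (suc r) ⟩
    r + v₂ (r !)                                        ≤⟨ +-monoʳ-≤ r (rec (s≤s (m≤m+n r (r + 0)))) ⟩
    r + r                                               ≤⟨ n≤1+n (r + r) ⟩
    suc (r + r)                                         ≡⟨ cong (λ z → suc (r + z)) (+-identityʳ r) ⟨
    suc (2 * r)                                         ∎
    where open ≤-Reasoning

2^Σv₂∥n! : ∀ n → 2^ sumBelow n (λ k → v₂ (suc k)) ∥ n !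
2^Σv₂∥n! zero    = 0 , refl
2^Σv₂∥n! (suc n) = subst (λ e → 2^ e ∥ suc n !) (+-comm (v₂ (suc n)) _) (∥-* (2^v₂∥ (suc n)) (2^Σv₂∥n! n))

v₂[n!]≡Σv₂ : ∀ n → v₂ (n !) ≡ sumBelow n (λ k → v₂ (suc k))
v₂[n!]≡Σv₂ n = ∥⇒v₂≡ (2^Σv₂∥n! n)

-- Fermat's little theorem

prime⇒>1 : Prime p → 1 < p
prime⇒>1 p-prime = nonTrivial⇒n>1 _ {{prime⇒nonTrivial p-prime}}

p∤n! : Prime p → n < p → ¬ p ∣ n !
p∤n! {p} {zero}  p-prime _ p∣1 = <⇒≱ (prime⇒>1 p-prime) (∣⇒≤ p∣1)
p∤n! {p} {suc n} p-prime n<p p∣n! with euclidsLemma (suc n) (n !) p-prime p∣n!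
... | inj₁ p∣1+n = <⇒≱ n<p (∣⇒≤ p∣1+n)
... | inj₂ p∣n!  = p∤n! p-prime (<⇒≤ n<p) p∣n!

p∣pCk : Prime p → 0 < k → k < p → p ∣ p C k
p∣pCk {p@(suc p′)} {k} p-prime 0<k k<p with euclidsLemma (p C k) (k ! * (p ∸ k) !) p-prime p∣C*D
  where
  p∣C*D : p ∣ (p C k) * (k ! * (p ∸ k) !)
  p∣C*D = subst (p ∣_) (begin
    p !                                            ≡⟨ m/n*n≡m {{k !* (p ∸ k) !≢0}} (k![n∸k]!∣n! (<⇒≤ k<p)) ⟨
    (p ! / (k ! * (p ∸ k) !)) {{_}} * (k ! * (p ∸ k) !) ≡⟨ cong (_* (k ! * (p ∸ k) !)) (nCk≡n!/k![n-k]! (<⇒≤ k<p)) ⟨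
    (p C k) * (k ! * (p ∸ k) !)                    ∎) (m∣m*n (p′ !))
    where open ≡-Reasoning
... | inj₁ p∣C = p∣C
... | inj₂ p∣D with euclidsLemma (k !) ((p ∸ k) !) p-prime p∣D
...   | inj₁ p∣k!     = ⊥-elim (p∤n! p-prime k<p p∣k!)
...   | inj₂ p∣[p∸k]! = ⊥-elim (p∤n! p-prime (∸-monoʳ-< 0<k (<⇒≤ k<p)) p∣[p∸k]!)

private
  ×≡* : ∀ n x → n Additive.× x ≡ n * x
  ×≡* zero    x = refl
  ×≡* (suc n) x = cong (λ z → x + z) (×≡* n x)

  ^ᴬ≡^ : ∀ x n → x Semiring.^ n ≡ x ^ n
  ^ᴬ≡^ x zero    = refl
  ^ᴬ≡^ x (suc n) = cong (x *_) (^ᴬ≡^ x n)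

  ∣sum : ∀ {d n} (f : Vector ℕ n) → (∀ i → d ∣ f i) → d ∣ sum f
  ∣sum {n = zero}  f d∣f = divides 0 refl
  ∣sum {n = suc n} f d∣f = ∣m∣n⇒∣m+n (d∣f zero) (∣sum (λ i → f (suc i)) (λ i → d∣f (suc i)))

-- Binomial theorem: the inner coefficients p C k, 0 < k < p, are divisible by p.
[x+1]^p≡x^p+1+Mp : Prime p → ∀ x → ∃[ M ] (x + 1) ^ p ≡ x ^ p + 1 + M * p
[x+1]^p≡x^p+1+Mp {p@(suc p′)} p-prime x = quotient p∣inner , (begin
  (x + 1) ^ p                                      ≡⟨ ^ᴬ≡^ (x + 1) p ⟨
  (x + 1) Semiring.^ p                             ≡⟨ Binomial.theorem p x 1 ⟩
  t zero + sum (λ k → t (suc k))                   ≡⟨ cong₂ _+_ (term zero) (sum-init-last (λ k → t (suc k))) ⟩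
  1 * 1 + (inner + last)                           ≡⟨ cong (λ z → 1 * 1 + (z + last)) (m∣n⇒n≡quotient*m p∣inner) ⟩
  1 + (quotient p∣inner * p + last)                ≡⟨ cong (λ z → 1 + (quotient p∣inner * p + z)) last≡x^p ⟩
  1 + (quotient p∣inner * p + x ^ p)               ≡⟨ regroup 1 (quotient p∣inner * p) (x ^ p) ⟩
  x ^ p + 1 + quotient p∣inner * p                 ∎)
  where
  open ≡-Reasoning
  t : Vector ℕ (suc p)
  t = Binomial.binomialTerm x 1 p
  inner = sum (λ i → t (suc (inject₁ i)))
  last  = t (suc (fromℕ p′))
  term : ∀ k → t k ≡ (p C toℕ k) * x ^ toℕ k
  term k = begin
    t k                                                      ≡⟨ ×≡* (p C toℕ k) _ ⟩
    (p C toℕ k) * (x Semiring.^ toℕ k * 1 Semiring.^ (p ∸ toℕ k))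
      ≡⟨ cong₂ (λ a b → (p C toℕ k) * (a * b)) (^ᴬ≡^ x (toℕ k)) (trans (^ᴬ≡^ 1 (p ∸ toℕ k)) (^-zeroˡ (p ∸ toℕ k))) ⟩
    (p C toℕ k) * (x ^ toℕ k * 1)                            ≡⟨ cong ((p C toℕ k) *_) (*-identityʳ (x ^ toℕ k)) ⟩
    (p C toℕ k) * x ^ toℕ k                                  ∎
  p∣inner : p ∣ inner
  p∣inner = ∣sum _ λ i → subst (p ∣_) (sym (term (suc (inject₁ i))))
    (∣m⇒∣m*n _ (p∣pCk p-prime z<s (s≤s (subst (_< p′) (sym (toℕ-inject₁ i)) (toℕ<n i)))))
  last≡x^p : last ≡ x ^ p
  last≡x^p = begin
    last                                 ≡⟨ term (suc (fromℕ p′)) ⟩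
    (p C toℕ (suc (fromℕ p′))) * x ^ toℕ (suc (fromℕ p′)) ≡⟨ cong (λ i → (p C i) * x ^ i) (cong suc (toℕ-fromℕ p′)) ⟩
    (p C p) * x ^ p                      ≡⟨ cong (_* x ^ p) (nCn≡1 p) ⟩
    1 * x ^ p                            ≡⟨ *-identityˡ (x ^ p) ⟩
    x ^ p                                ∎
  regroup : ∀ a b c → a + (b + c) ≡ c + a + b
  regroup = solve-∀

x^p≡x+Mp : Prime p → ∀ x → ∃[ M ] x ^ p ≡ x + M * p
x^p≡x+Mp {suc p′} p-prime zero    = 0 , refl
x^p≡x+Mp {p}      p-prime (suc x) with x^p≡x+Mp p-prime x | [x+1]^p≡x^p+1+Mp p-prime x
... | M₀ , x^p≡ | M₁ , [x+1]^p≡ = M₀ + M₁ , (begin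
  suc x ^ p                      ≡⟨ cong (_^ p) (+-comm 1 x) ⟩
  (x + 1) ^ p                    ≡⟨ [x+1]^p≡ ⟩
  x ^ p + 1 + M₁ * p             ≡⟨ cong (λ z → z + 1 + M₁ * p) x^p≡ ⟩
  x + M₀ * p + 1 + M₁ * p        ≡⟨ regroup x M₀ M₁ p ⟩
  suc x + (M₀ + M₁) * p          ∎)
  where
  open ≡-Reasoning
  regroup : ∀ x a b p → x + a * p + 1 + b * p ≡ suc x + (a + b) * p
  regroup = solve-∀

infix 4 _≡_mod_

record _≡_mod_ (i j : ℤ) (p : ℕ) : Set where
  constructor mod-intro
  field
    ∣difference : + p ℤ∣.∣ i ℤ.- j

module _ {p : ℕ} where

  ≡⇒≡-mod : i ≡ j → i ≡ j mod p
  ≡⇒≡-mod {i} refl = mod-intro (ℤ∣.divides 0ℤ (ℤₚ.+-inverseʳ i))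

  ≡-mod-sym : i ≡ j mod p → j ≡ i mod p
  ≡-mod-sym {i} {j} (mod-intro p∣i-j) = mod-intro (subst (+ p ℤ∣.∣_) (negate i j) (ℤ∣.∣m⇒∣-m p∣i-j))
    where
    negate : ∀ i j → ℤ.- (i ℤ.- j) ≡ j ℤ.- i
    negate = ℤ-solve-∀

  ≡-mod-trans : i ≡ j mod p → j ≡ i′ mod p → i ≡ i′ mod p
  ≡-mod-trans {i} {j} {i′} (mod-intro p∣i-j) (mod-intro p∣j-i′) =
    mod-intro (subst (+ p ℤ∣.∣_) (telescope i j i′) (ℤ∣.∣m∣n⇒∣m+n p∣i-j p∣j-i′))
    where
    telescope : ∀ i j k → (i ℤ.- j) ℤ.+ (j ℤ.- k) ≡ i ℤ.- k
    telescope = ℤ-solve-∀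

  ≡-mod-isEquivalence : IsEquivalence (_≡_mod p)
  ≡-mod-isEquivalence = record { refl = ≡⇒≡-mod refl ; sym = ≡-mod-sym ; trans = ≡-mod-trans }

  *-cong-mod : i ≡ j mod p → i′ ≡ j′ mod p → i ℤ.* i′ ≡ j ℤ.* j′ mod p
  *-cong-mod {i} {j} {i′} {j′} (mod-intro p∣i-j) (mod-intro p∣i′-j′) = mod-intro
    (subst (+ p ℤ∣.∣_) (expand i j i′ j′) (ℤ∣.∣m∣n⇒∣m+n (ℤ∣.∣n⇒∣m*n i p∣i′-j′) (ℤ∣.∣m⇒∣m*n j′ p∣i-j)))
    where
    expand : ∀ i j i′ j′ → i ℤ.* (i′ ℤ.- j′) ℤ.+ (i ℤ.- j) ℤ.* j′ ≡ i ℤ.* i′ ℤ.- j ℤ.* j′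
    expand = ℤ-solve-∀

  *-congˡ-mod : ∀ i → j ≡ j′ mod p → i ℤ.* j ≡ i ℤ.* j′ mod p
  *-congˡ-mod i = *-cong-mod (≡⇒≡-mod {i = i} refl)

  ^-cong-mod : ∀ n → i ≡ j mod p → i ℤ.^ n ≡ j ℤ.^ n mod p
  ^-cong-mod zero    _   = ≡⇒≡-mod refl
  ^-cong-mod (suc n) i≡j = *-cong-mod i≡j (^-cong-mod n i≡j)

  -‿cong-mod : i ≡ j mod p → ℤ.- i ≡ ℤ.- j mod p
  -‿cong-mod {i} {j} i≡j = subst₂ (_≡_mod p) (ℤₚ.-1*i≡-i i) (ℤₚ.-1*i≡-i j) (*-cong-mod (≡⇒≡-mod {i = -1ℤ} refl) i≡j)

mod-setoid : ℕ → Setoid _ _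
mod-setoid p = record { isEquivalence = ≡-mod-isEquivalence {p} }

module ≡-mod-Reasoning (p : ℕ) = SetoidReasoning (mod-setoid p)

*-cancelʳ-mod : Prime p → ¬ p ∣ c → i ℤ.* + c ≡ j ℤ.* + c mod p → i ≡ j mod p
*-cancelʳ-mod {p} {c} {i} {j} p-prime p∤c (mod-intro p∣ic-jc)
  with euclidsLemma ℤ.∣ i ℤ.- j ∣ c p-prime
         (subst (p ∣_) (ℤₚ.abs-* (i ℤ.- j) (+ c)) (ℤ∣.∣⇒∣ᵤ (subst (+ p ℤ∣.∣_) (factor i j (+ c)) p∣ic-jc)))
  where
  factor : ∀ i j k → i ℤ.* k ℤ.- j ℤ.* k ≡ (i ℤ.- j) ℤ.* k
  factor = ℤ-solve-∀
... | inj₁ p∣i-j = mod-intro (ℤ∣.∣ᵤ⇒∣ p∣i-j)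
... | inj₂ p∣c   = ⊥-elim (p∤c p∣c)

1≢-1-mod : 2 < p → ¬ 1ℤ ≡ -1ℤ mod p
1≢-1-mod 2<p (mod-intro p∣2) = <⇒≱ 2<p (∣⇒≤ (ℤ∣.∣⇒∣ᵤ p∣2))

+[m^n]≡[+m]^n : ∀ m n → + (m ^ n) ≡ (+ m) ℤ.^ n
+[m^n]≡[+m]^n m zero    = refl
+[m^n]≡[+m]^n m (suc n) = trans (ℤₚ.pos-* m (m ^ n)) (cong (+ m ℤ.*_) (+[m^n]≡[+m]^n m n))

fermat-little : Prime p → p ≡ suc n → ¬ p ∣ x → (+ x) ℤ.^ n ≡ 1ℤ mod p
fermat-little {p} {n} {x} p-prime p≡1+n p∤x = *-cancelʳ-mod p-prime p∤x (begin
  (+ x) ℤ.^ n ℤ.* + x    ≡⟨ ℤₚ.*-comm ((+ x) ℤ.^ n) (+ x) ⟩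
  (+ x) ℤ.^ suc n        ≡⟨ +[m^n]≡[+m]^n x (suc n) ⟨
  + (x ^ suc n)          ≡⟨ cong (λ k → + (x ^ k)) p≡1+n ⟨
  + (x ^ p)              ≈⟨ +x^p≡+x ⟩
  + x                    ≡⟨ ℤₚ.*-identityˡ (+ x) ⟨
  1ℤ ℤ.* + x             ∎)
  where
  open ≡-mod-Reasoning p
  +x^p≡+x : + (x ^ p) ≡ + x mod p
  +x^p≡+x with x^p≡x+Mp p-prime x
  ... | M , x^p≡ = mod-intro (ℤ∣.divides (+ M) (trans (cong (λ z → + z ℤ.- + x) x^p≡) (difference x M p)))
    where
    difference : ∀ x M p → + (x + M * p) ℤ.- + x ≡ + M ℤ.* + p
    difference x M p = trans (cong (ℤ._- + x) (trans (ℤₚ.pos-+ x (M * p)) (cong (λ z → + x ℤ.+ z) (ℤₚ.pos-* M p))))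
                             (cancel (+ x) (+ M ℤ.* + p))
      where
      cancel : ∀ a b → a ℤ.+ b ℤ.- a ≡ b
      cancel = ℤ-solve-∀

p∣x²+c⇒x²≡-c : p ∣ x * x + c → (+ x) ℤ.^ 2 ≡ ℤ.- + c mod p
p∣x²+c⇒x²≡-c {p} {x} {c} p∣x²+c = mod-intro (subst (+ p ℤ∣.∣_) (begin
  + (x * x + c)                       ≡⟨ ℤₚ.pos-+ (x * x) c ⟩
  + (x * x) ℤ.+ + c                   ≡⟨ cong (ℤ._+ + c) (ℤₚ.pos-* x x) ⟩
  + x ℤ.* + x ℤ.+ + c                 ≡⟨ square (+ x) (+ c) ⟩
  (+ x) ℤ.^ 2 ℤ.- ℤ.- + c             ∎) (ℤ∣.∣ᵤ⇒∣ p∣x²+c))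
  where
  open ≡-Reasoning
  square : ∀ i k → i ℤ.* i ℤ.+ k ≡ i ℤ.* (i ℤ.* 1ℤ) ℤ.- ℤ.- k
  square = ℤ-solve-∀

-- Quadratic non-residues

odd-prime⇒2<p : ∀ {h} → Prime p → p ≡ suc (2 * h) → 2 < p
odd-prime⇒2<p {p} {h} p-prime p≡1+2h = ≤∧≢⇒< (prime⇒>1 p-prime) λ 2≡p → 1+2a≢2b h 1 (trans (sym p≡1+2h) (sym 2≡p))

p∤x²+c : ∀ {h} → Prime p → p ≡ suc (2 * h) → ¬ p ∣ c → (ℤ.- + c) ℤ.^ h ≡ -1ℤ mod p → ¬ p ∣ x * x + c
p∤x²+c {p} {c} {x} {h} p-prime p≡1+2h p∤c [-c]^h≡-1 p∣x²+c = 1≢-1-mod (odd-prime⇒2<p {h = h} p-prime p≡1+2h) (begin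
  1ℤ                   ≈⟨ fermat-little {n = 2 * h} p-prime p≡1+2h p∤x ⟨
  (+ x) ℤ.^ (2 * h)    ≡⟨ ℤₚ.^-*-assoc (+ x) 2 h ⟨
  ((+ x) ℤ.^ 2) ℤ.^ h  ≈⟨ ^-cong-mod h (p∣x²+c⇒x²≡-c {x = x} p∣x²+c) ⟩
  (ℤ.- + c) ℤ.^ h      ≈⟨ [-c]^h≡-1 ⟩
  -1ℤ                  ∎)
  where
  open ≡-mod-Reasoning p
  p∤x : ¬ p ∣ x
  p∤x p∣x = p∤c (∣m+n∣m⇒∣n p∣x²+c (∣m⇒∣m*n x p∣x))

[-i]^[1+2t]≡-i^[1+2t] : ∀ i t → (ℤ.- i) ℤ.^ suc (2 * t) ≡ ℤ.- (i ℤ.^ suc (2 * t))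
[-i]^[1+2t]≡-i^[1+2t] i t = begin
  ℤ.- i ℤ.* (ℤ.- i) ℤ.^ (2 * t)        ≡⟨ cong (ℤ.- i ℤ.*_) (ℤₚ.^-*-assoc (ℤ.- i) 2 t) ⟨
  ℤ.- i ℤ.* ((ℤ.- i) ℤ.^ 2) ℤ.^ t      ≡⟨ cong (λ z → ℤ.- i ℤ.* z ℤ.^ t) (square i) ⟩
  ℤ.- i ℤ.* (i ℤ.^ 2) ℤ.^ t            ≡⟨ cong (ℤ.- i ℤ.*_) (ℤₚ.^-*-assoc i 2 t) ⟩
  ℤ.- i ℤ.* i ℤ.^ (2 * t)              ≡⟨ ℤₚ.neg-distribˡ-* i (i ℤ.^ (2 * t)) ⟨
  ℤ.- (i ℤ.^ suc (2 * t))              ∎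
  where
  open ≡-Reasoning
  square : ∀ i → ℤ.- i ℤ.* (ℤ.- i ℤ.* 1ℤ) ≡ i ℤ.* (i ℤ.* 1ℤ)
  square = ℤ-solve-∀

p∤2 : 2 < p → ¬ p ∣ 2
p∤2 2<p p∣2 = <⇒≱ 2<p (∣⇒≤ p∣2)

[-4]^h≡-1 : ∀ {h t} → Prime p → p ≡ suc (2 * h) → h ≡ suc (2 * t) → (ℤ.- + 4) ℤ.^ h ≡ -1ℤ mod p
[-4]^h≡-1 {p} {h} {t} p-prime p≡1+2h refl = begin
  (ℤ.- + 4) ℤ.^ h              ≡⟨ [-i]^[1+2t]≡-i^[1+2t] (+ 4) t ⟩
  ℤ.- ((+ 2) ℤ.^ 2) ℤ.^ h      ≡⟨ cong ℤ.-_ (ℤₚ.^-*-assoc (+ 2) 2 h) ⟩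
  ℤ.- (+ 2) ℤ.^ (2 * h)        ≈⟨ -‿cong-mod (fermat-little {n = 2 * h} p-prime p≡1+2h (p∤2 2<p)) ⟩
  -1ℤ                          ∎
  where
  open ≡-mod-Reasoning p
  2<p = odd-prime⇒2<p {h = h} p-prime p≡1+2h

m+n≡p⇒+m≡-+n : m + n ≡ p → + m ≡ ℤ.- + n mod p
m+n≡p⇒+m≡-+n {m} {n} {p} m+n≡p = mod-intro (ℤ∣.divides 1ℤ (begin
  + m ℤ.- ℤ.- + n       ≡⟨ minus-negate (+ m) (+ n) ⟩
  + m ℤ.+ + n           ≡⟨ ℤₚ.pos-+ m n ⟨
  + (m + n)             ≡⟨ cong +_ m+n≡p ⟩
  + p                   ≡⟨ ℤₚ.*-identityˡ (+ p) ⟨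
  1ℤ ℤ.* + p            ∎))
  where
  open ≡-Reasoning
  minus-negate : ∀ i j → i ℤ.- ℤ.- j ≡ i ℤ.+ j
  minus-negate = ℤ-solve-∀

-2ℤ : ℤ
-2ℤ = ℤ.- + 2

-- Gauss's lemma for 2: modulo 2 (r + m) + 1, the odd factor 2 i + 1 is congruent to -2 (r + m - i).
r!*oddProduct[m]≡[-2]^m*[r+m]! : ∀ m r →
  + (r !) ℤ.* + oddProduct m ≡ -2ℤ ℤ.^ m ℤ.* + ((r + m) !) mod suc (2 * (r + m))
r!*oddProduct[m]≡[-2]^m*[r+m]! zero    r = ≡⇒≡-mod (begin
  + (r !) ℤ.* 1ℤ            ≡⟨ ℤₚ.*-identityʳ (+ (r !)) ⟩
  + (r !)                   ≡⟨ cong (λ k → + (k !)) (+-identityʳ r) ⟨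
  + ((r + 0) !)             ≡⟨ ℤₚ.*-identityˡ _ ⟨
  1ℤ ℤ.* + ((r + 0) !)      ∎)
  where open ≡-Reasoning
r!*oddProduct[m]≡[-2]^m*[r+m]! (suc m) r = begin
  + (r !) ℤ.* + (oddProduct m * suc (2 * m))
    ≡⟨ cong (+ (r !) ℤ.*_) (ℤₚ.pos-* (oddProduct m) (suc (2 * m))) ⟩
  + (r !) ℤ.* (+ oddProduct m ℤ.* + suc (2 * m))
    ≈⟨ *-congˡ-mod (+ (r !)) (*-congˡ-mod (+ oddProduct m) 1+2m≡-2[1+r]) ⟩
  + (r !) ℤ.* (+ oddProduct m ℤ.* (-2ℤ ℤ.* + suc r))
    ≡⟨ regroup (+ (r !)) (+ oddProduct m) (+ suc r) ⟩
  -2ℤ ℤ.* (+ suc r ℤ.* + (r !) ℤ.* + oddProduct m)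
    ≡⟨ cong (λ z → -2ℤ ℤ.* (z ℤ.* + oddProduct m)) (ℤₚ.pos-* (suc r) (r !)) ⟨
  -2ℤ ℤ.* (+ (suc r !) ℤ.* + oddProduct m)
    ≈⟨ *-congˡ-mod -2ℤ induction-hypothesis ⟩
  -2ℤ ℤ.* (-2ℤ ℤ.^ m ℤ.* + ((suc r + m) !))
    ≡⟨ ℤₚ.*-assoc -2ℤ (-2ℤ ℤ.^ m) _ ⟨
  -2ℤ ℤ.^ suc m ℤ.* + ((suc r + m) !)
    ≡⟨ cong (λ k → -2ℤ ℤ.^ suc m ℤ.* + (k !)) (+-suc r m) ⟨
  -2ℤ ℤ.^ suc m ℤ.* + ((r + suc m) !) ∎
  where
  open ≡-mod-Reasoning (suc (2 * (r + suc m)))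
  induction-hypothesis :
    + (suc r !) ℤ.* + oddProduct m ≡ -2ℤ ℤ.^ m ℤ.* + ((suc r + m) !) mod suc (2 * (r + suc m))
  induction-hypothesis = subst (λ k → + (suc r !) ℤ.* + oddProduct m ≡ -2ℤ ℤ.^ m ℤ.* + ((suc r + m) !) mod suc (2 * k))
                               (sym (+-suc r m)) (r!*oddProduct[m]≡[-2]^m*[r+m]! m (suc r))
  regroup : ∀ a b c → a ℤ.* (b ℤ.* (-2ℤ ℤ.* c)) ≡ -2ℤ ℤ.* (c ℤ.* a ℤ.* b)
  regroup = ℤ-solve-∀
  1+2m≡-2[1+r] : + suc (2 * m) ≡ -2ℤ ℤ.* + suc r mod suc (2 * (r + suc m))
  1+2m≡-2[1+r] = subst (λ z → + suc (2 * m) ≡ z mod suc (2 * (r + suc m)))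
    (trans (cong ℤ.-_ (ℤₚ.pos-* 2 (suc r))) (ℤₚ.neg-distribˡ-* (+ 2) (+ suc r)))
    (m+n≡p⇒+m≡-+n {n = 2 * suc r} (total m r))
    where
    total : ∀ m r → suc (2 * m) + 2 * suc r ≡ suc (2 * (r + suc m))
    total = solve-∀

[r+m]!≡2^r*r!*oddProduct[m] : m ≡ r ⊎ m ≡ suc r → (r + m) ! ≡ 2 ^ r * r ! * oddProduct m
[r+m]!≡2^r*r!*oddProduct[m] {r = r} (inj₁ refl) =
  trans (cong (λ z → (r + z) !) (sym (+-identityʳ r))) (proj₁ ([2r]!≡2^r*r!*oddProduct r))
[r+m]!≡2^r*r!*oddProduct[m] {r = r} (inj₂ refl) =
  trans (cong _! (trans (+-suc r r) (cong (λ z → suc (r + z)) (sym (+-identityʳ r)))))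
        (proj₂ ([2r]!≡2^r*r!*oddProduct r))

2^r*[-2]^m≡1 : Prime p → p ≡ suc (2 * (r + m)) → m ≡ r ⊎ m ≡ suc r → (+ 2) ℤ.^ r ℤ.* -2ℤ ℤ.^ m ≡ 1ℤ mod p
2^r*[-2]^m≡1 {p} {r} {m} p-prime p≡ m≡r∨1+r = *-cancelʳ-mod p-prime p∤[r+m]! (begin
  (+ 2) ℤ.^ r ℤ.* -2ℤ ℤ.^ m ℤ.* + ((r + m) !)     ≡⟨ ℤₚ.*-assoc ((+ 2) ℤ.^ r) (-2ℤ ℤ.^ m) _ ⟩
  (+ 2) ℤ.^ r ℤ.* (-2ℤ ℤ.^ m ℤ.* + ((r + m) !))   ≈⟨ *-congˡ-mod ((+ 2) ℤ.^ r) gauss ⟨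
  (+ 2) ℤ.^ r ℤ.* (+ (r !) ℤ.* + oddProduct m)    ≡⟨ cong ((+ 2) ℤ.^ r ℤ.*_) (ℤₚ.pos-* (r !) (oddProduct m)) ⟨
  (+ 2) ℤ.^ r ℤ.* + (r ! * oddProduct m)          ≡⟨ cong (ℤ._* + (r ! * oddProduct m)) (+[m^n]≡[+m]^n 2 r) ⟨
  + (2 ^ r) ℤ.* + (r ! * oddProduct m)            ≡⟨ ℤₚ.pos-* (2 ^ r) (r ! * oddProduct m) ⟨
  + (2 ^ r * (r ! * oddProduct m))                ≡⟨ cong +_ (*-assoc (2 ^ r) (r !) (oddProduct m)) ⟨
  + (2 ^ r * r ! * oddProduct m)                  ≡⟨ cong +_ ([r+m]!≡2^r*r!*oddProduct[m] m≡r∨1+r) ⟨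
  + ((r + m) !)                                   ≡⟨ ℤₚ.*-identityˡ _ ⟨
  1ℤ ℤ.* + ((r + m) !)                            ∎)
  where
  open ≡-mod-Reasoning p
  p∤[r+m]! : ¬ p ∣ (r + m) !
  p∤[r+m]! = p∤n! p-prime (subst (r + m <_) (sym p≡) (s≤s (m≤n*m (r + m) 2)))
  gauss : + (r !) ℤ.* + oddProduct m ≡ -2ℤ ℤ.^ m ℤ.* + ((r + m) !) mod p
  gauss = subst (+ (r !) ℤ.* + oddProduct m ≡ -2ℤ ℤ.^ m ℤ.* + ((r + m) !) mod_) (sym p≡)
                (r!*oddProduct[m]≡[-2]^m*[r+m]! m r)

[-2]^[r+m]≡-1 : ∀ {t} → Prime p → p ≡ suc (2 * (r + m)) → r ≡ suc (2 * t) → m ≡ r ⊎ m ≡ suc r →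
                -2ℤ ℤ.^ (r + m) ≡ -1ℤ mod p
[-2]^[r+m]≡-1 {p} {r} {m} {t} p-prime p≡ refl m≡r∨1+r = begin
  -2ℤ ℤ.^ (r + m)                          ≡⟨ ℤₚ.^-distribˡ-+-* -2ℤ r m ⟩
  -2ℤ ℤ.^ r ℤ.* -2ℤ ℤ.^ m                  ≡⟨ cong (ℤ._* -2ℤ ℤ.^ m) ([-i]^[1+2t]≡-i^[1+2t] (+ 2) t) ⟩
  ℤ.- (+ 2) ℤ.^ r ℤ.* -2ℤ ℤ.^ m            ≡⟨ ℤₚ.neg-distribˡ-* ((+ 2) ℤ.^ r) (-2ℤ ℤ.^ m) ⟨
  ℤ.- ((+ 2) ℤ.^ r ℤ.* -2ℤ ℤ.^ m)          ≈⟨ -‿cong-mod (2^r*[-2]^m≡1 p-prime p≡ m≡r∨1+r) ⟩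
  -1ℤ                                      ∎
  where open ≡-mod-Reasoning p

-- Primes in residue classes modulo 8

data OddResidueMod8 (n : ℕ) : Set where
  ≡1mod8 : ∀ t → n ≡ 1 + 8 * t → OddResidueMod8 n
  ≡3mod8 : ∀ t → n ≡ 3 + 8 * t → OddResidueMod8 n
  ≡5mod8 : ∀ t → n ≡ 5 + 8 * t → OddResidueMod8 n
  ≡7mod8 : ∀ t → n ≡ 7 + 8 * t → OddResidueMod8 n

oddResidueMod8 : n ≡ suc (2 * s) → OddResidueMod8 n
oddResidueMod8 {n} {s} n≡1+2s =
  classify (n % 8) (n / 8) (m%n<n n 8) (trans (m≡m%n+[m/n]*n n 8) (cong (λ z → n % 8 + z) (*-comm (n / 8) 8)))
  where
  not-even : ∀ k t → n ≢ 2 * k + 8 * t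
  not-even k t n≡2k+8t = 1+2a≢2b s (k + 4 * t) (trans (sym n≡1+2s) (trans n≡2k+8t (halve k t)))
    where
    halve : ∀ k t → 2 * k + 8 * t ≡ 2 * (k + 4 * t)
    halve = solve-∀
  classify : ∀ ρ t → ρ < 8 → n ≡ ρ + 8 * t → OddResidueMod8 n
  classify 0 t _ n≡ = ⊥-elim (not-even 0 t n≡)
  classify 1 t _ n≡ = ≡1mod8 t n≡
  classify 2 t _ n≡ = ⊥-elim (not-even 1 t n≡)
  classify 3 t _ n≡ = ≡3mod8 t n≡
  classify 4 t _ n≡ = ⊥-elim (not-even 2 t n≡)
  classify 5 t _ n≡ = ≡5mod8 t n≡
  classify 6 t _ n≡ = ⊥-elim (not-even 3 t n≡)
  classify 7 t _ n≡ = ≡7mod8 t n≡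
  classify (suc (suc (suc (suc (suc (suc (suc (suc _)))))))) _ (s≤s (s≤s (s≤s (s≤s (s≤s (s≤s (s≤s (s≤s ())))))))) _

[ρ+8t]%n≡ρ%n : ∀ ρ t n .{{_ : NonZero n}} → n ∣ 8 → (ρ + 8 * t) % n ≡ ρ % n
[ρ+8t]%n≡ρ%n ρ t n (divides k 8≡kn) = trans (cong (λ z → (ρ + z) % n) (8t≡[tk]n t)) ([m+kn]%n≡m%n ρ (t * k) n)
  where
  8t≡[tk]n : ∀ t → 8 * t ≡ t * k * n
  8t≡[tk]n t = trans (cong (_* t) 8≡kn) (trans (*-comm (k * n) t) (sym (*-assoc t k n)))

normQi[5+8t]≡5+8t : ∀ t → normQi (5 + 8 * t) ≡ 5 + 8 * t
normQi[5+8t]≡5+8t t = cong (normQiAux (5 + 8 * t)) ([ρ+8t]%n≡ρ%n 5 t 4 (divides 2 refl))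

normQi-odd≡1+4u : n ≡ suc (2 * s) → ∃[ u ] normQi n ≡ 1 + 4 * u
normQi-odd≡1+4u {s = s} n≡1+2s with oddResidueMod8 {s = s} n≡1+2s
... | ≡1mod8 t refl = 2 * t , trans (cong (normQiAux _) ([ρ+8t]%n≡ρ%n 1 t 4 (divides 2 refl))) (arith t)
  where
  arith : ∀ t → 1 + 8 * t ≡ 1 + 4 * (2 * t)
  arith = solve-∀
... | ≡3mod8 t refl =
  2 + 12 * t + 16 * t * t , trans (cong (normQiAux _) ([ρ+8t]%n≡ρ%n 3 t 4 (divides 2 refl))) (arith t)
  where
  arith : ∀ t → (3 + 8 * t) * (3 + 8 * t) ≡ 1 + 4 * (2 + 12 * t + 16 * t * t)
  arith = solve-∀
... | ≡5mod8 t refl = 1 + 2 * t , trans (normQi[5+8t]≡5+8t t) (arith t)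
  where
  arith : ∀ t → 5 + 8 * t ≡ 1 + 4 * (1 + 2 * t)
  arith = solve-∀
... | ≡7mod8 t refl =
  12 + 28 * t + 16 * t * t , trans (cong (normQiAux _) ([ρ+8t]%n≡ρ%n 7 t 4 (divides 2 refl))) (arith t)
  where
  arith : ∀ t → (7 + 8 * t) * (7 + 8 * t) ≡ 1 + 4 * (12 + 28 * t + 16 * t * t)
  arith = solve-∀

∣odd⇒odd : ∀ {a} → p ∣ suc (2 * a) → ∃[ s ] p ≡ suc (2 * s)
∣odd⇒odd {p} {a} p∣1+2a with even-or-odd p
... | inj₂ p-odd = p-odd
... | inj₁ (k , refl) with p∣1+2a
...   | divides q 1+2a≡q*2k = ⊥-elim (1+2a≢2b a (q * k) (trans 1+2a≡q*2k (swap q k)))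
  where
  swap : ∀ q k → q * (2 * k) ≡ 2 * (q * k)
  swap = solve-∀

prime≥3⇒odd : Prime p → 3 ≤ p → ∃[ s ] p ≡ suc (2 * s)
prime≥3⇒odd {p} p-prime 3≤p with even-or-odd p
... | inj₂ p-odd = p-odd
... | inj₁ (k , p≡2k) with prime⇒irreducible p-prime (divides k (trans p≡2k (*-comm 2 k)))
...   | inj₁ ()
...   | inj₂ 2≡p = ⊥-elim (<⇒≢ 3≤p 2≡p)

[1+2s]²≡1+8T : ∀ s → ∃[ T ] suc (2 * s) * suc (2 * s) ≡ 1 + 8 * T
[1+2s]²≡1+8T s with even-or-odd s
... | inj₁ (k , refl) = k + 2 * k * k , arith k
  where
  arith : ∀ k → suc (2 * (2 * k)) * suc (2 * (2 * k)) ≡ 1 + 8 * (k + 2 * k * k)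
  arith = solve-∀
... | inj₂ (k , refl) = 1 + 3 * k + 2 * k * k , arith k
  where
  arith : ∀ k → suc (2 * suc (2 * k)) * suc (2 * suc (2 * k)) ≡ 1 + 8 * (1 + 3 * k + 2 * k * k)
  arith = solve-∀

∃prime∣n∧≢1mod8 : ∀ n .{{_ : NonZero n}} → n % 8 ≢ 1 → ∃[ p ] Prime p × p ∣ n × p % 8 ≢ 1
∃prime∣n∧≢1mod8 n n≢1 =
  let p , p-prime , p∣∏ , p≢1 = search factors factorsPrime (λ ∏≡1 → n≢1 (trans (cong (_% 8) isFactorisation) ∏≡1))
  in p , p-prime , subst (p ∣_) (sym isFactorisation) p∣∏ , p≢1
  where
  open PrimeFactorisation (factorise n)
  search : ∀ ps → All Prime ps → product ps % 8 ≢ 1 → ∃[ p ] Prime p × p ∣ product ps × p % 8 ≢ 1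
  search []       _                 1≢1 = ⊥-elim (1≢1 refl)
  search (p ∷ ps) (p-prime ∷ prime) ∏≢1 with p % 8 ≟ 1
  ... | no  p≢1 = p , p-prime , m∣m*n (product ps) , p≢1
  ... | yes p≡1 = let q , q-prime , q∣∏ , q≢1 = search ps prime λ ∏ps≡1 → ∏≢1 (begin
                        p * product ps % 8                 ≡⟨ %-distribˡ-* p (product ps) 8 ⟩
                        (p % 8) * (product ps % 8) % 8     ≡⟨ cong₂ (λ a b → a * b % 8) p≡1 ∏ps≡1 ⟩
                        1                                  ∎)
                  in q , q-prime , ∣n⇒∣m*n p q∣∏ , q≢1
    where open ≡-Reasoning

oddProduct-odd : ∀ m → ∃[ u ] oddProduct m ≡ suc (2 * u)
oddProduct-odd m = let u , ∏≡ = 2^0∥oddProduct m in u , trans ∏≡ (+-identityʳ _)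

oddProduct²+2k≡1+2k+8T : ∀ B k → ∃[ T ] oddProduct B * oddProduct B + 2 * k ≡ 1 + 2 * k + 8 * T
oddProduct²+2k≡1+2k+8T B k with oddProduct-odd B
... | u , X≡1+2u with [1+2s]²≡1+8T u
...   | T , [1+2u]²≡1+8T =
  T , trans (cong (λ z → z * z + 2 * k) X≡1+2u) (trans (cong (_+ 2 * k) [1+2u]²≡1+8T) (regroup T k))
  where
  regroup : ∀ T k → 1 + 8 * T + 2 * k ≡ 1 + 2 * k + 8 * T
  regroup = solve-∀

[1+2k]%8≢1 : k ≡ 1 ⊎ k ≡ 2 → (1 + 2 * k) % 8 ≢ 1
[1+2k]%8≢1 (inj₁ refl) ()
[1+2k]%8≢1 (inj₂ refl) ()

odd-prime∤2k : Prime p → 2 < p → k ≡ 1 ⊎ k ≡ 2 → ¬ p ∣ 2 * k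
odd-prime∤2k p-prime 2<p (inj₁ refl) = p∤2 2<p
odd-prime∤2k p-prime 2<p (inj₂ refl) p∣4 = [ p∤2 2<p , p∤2 2<p ]′ (euclidsLemma 2 2 p-prime p∣4)

-- Every odd number below 2 B divides oddProduct B.
prime-divisor-of-oddProduct²+2k : ∀ B → Prime p → p ∣ oddProduct B * oddProduct B + 2 * k → k ≡ 1 ⊎ k ≡ 2 →
                            ¬ p ∣ 2 * k × B ≤ p × OddResidueMod8 p
prime-divisor-of-oddProduct²+2k {p} {k} B p-prime p∣N k≡1∨2 = p∤2k , B≤p , oddResidueMod8 {s = w} p≡1+2w
  where
  T = proj₁ (oddProduct²+2k≡1+2k+8T B k)
  N-odd : oddProduct B * oddProduct B + 2 * k ≡ suc (2 * (k + 4 * T))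
  N-odd = trans (proj₂ (oddProduct²+2k≡1+2k+8T B k)) (halve k T)
    where
    halve : ∀ k T → 1 + 2 * k + 8 * T ≡ suc (2 * (k + 4 * T))
    halve = solve-∀
  p-odd : ∃[ w ] p ≡ suc (2 * w)
  p-odd = ∣odd⇒odd {a = k + 4 * T} (subst (p ∣_) N-odd p∣N)
  w = proj₁ p-odd
  p≡1+2w : p ≡ suc (2 * w)
  p≡1+2w = proj₂ p-odd
  p∤2k : ¬ p ∣ 2 * k
  p∤2k = odd-prime∤2k p-prime (odd-prime⇒2<p {h = w} p-prime p≡1+2w) k≡1∨2
  w<B⇒p∣X : w < B → p ∣ oddProduct B
  w<B⇒p∣X w<B = subst (_∣ oddProduct B) (sym p≡1+2w) (∣prodBelow (λ k → suc (2 * k)) w<B)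
  B≤p : B ≤ p
  B≤p = [ (λ B≤w → ≤-trans B≤w (subst (w ≤_) (sym p≡1+2w) (≤-trans (m≤n*m w 2) (n≤1+n _))))
        , (λ w<B → ⊥-elim (p∤2k (∣m+n∣m⇒∣n p∣N (∣m⇒∣m*n (oddProduct B) (w<B⇒p∣X w<B)))))
        ]′ (≤-<-connex B w)

∃prime∣oddProduct²+2k∧≢1mod8 : ∀ B k → k ≡ 1 ⊎ k ≡ 2 →
  ∃[ p ] Prime p × p ∣ oddProduct B * oddProduct B + 2 * k × ¬ p ∣ 2 * k × B ≤ p × p % 8 ≢ 1 × OddResidueMod8 p
∃prime∣oddProduct²+2k∧≢1mod8 B k k≡1∨2 =
  let p , p-prime , p∣N , p≢1 = ∃prime∣n∧≢1mod8 N {{N≢0}} N≢1mod8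
      p∤2k , B≤p , residue = prime-divisor-of-oddProduct²+2k B p-prime p∣N k≡1∨2
  in p , p-prime , p∣N , p∤2k , B≤p , p≢1 , residue
  where
  N = oddProduct B * oddProduct B + 2 * k
  T = proj₁ (oddProduct²+2k≡1+2k+8T B k)
  N≡ : N ≡ 1 + 2 * k + 8 * T
  N≡ = proj₂ (oddProduct²+2k≡1+2k+8T B k)
  N≢0 : NonZero N
  N≢0 = subst NonZero (sym N≡) _
  N≢1mod8 : N % 8 ≢ 1
  N≢1mod8 N%8≡1 =
    [1+2k]%8≢1 k≡1∨2 (trans (sym ([ρ+8t]%n≡ρ%n (1 + 2 * k) T 8 ∣-refl)) (trans (cong (_% 8) (sym N≡)) N%8≡1))

-- -2 is a non-residue modulo primes ≡ 5, 7 (mod 8).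
∃prime≡3mod8 : ∀ B → ∃[ p ] Prime p × B ≤ p × ∃[ t ] p ≡ 3 + 8 * t
∃prime≡3mod8 B = select (∃prime∣oddProduct²+2k∧≢1mod8 B 1 (inj₁ refl))
  where
  select : ∃[ p ] Prime p × p ∣ oddProduct B * oddProduct B + 2 × ¬ p ∣ 2 × B ≤ p × p % 8 ≢ 1 × OddResidueMod8 p →
           ∃[ p ] Prime p × B ≤ p × ∃[ t ] p ≡ 3 + 8 * t
  select (p , p-prime , p∣N , p∤2 , B≤p , p≢1 , ≡1mod8 t refl) = ⊥-elim (p≢1 ([ρ+8t]%n≡ρ%n 1 t 8 ∣-refl))
  select (p , p-prime , p∣N , p∤2 , B≤p , p≢1 , ≡3mod8 t p≡)  = p , p-prime , B≤p , t , p≡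
  select (p , p-prime , p∣N , p∤2 , B≤p , p≢1 , ≡5mod8 t refl) =
    ⊥-elim (p∤x²+c {x = oddProduct B} p-prime p≡1+2h p∤2
      ([-2]^[r+m]≡-1 {r = suc (2 * t)} {m = suc (2 * t)} {t = t} p-prime p≡1+2h refl (inj₁ refl)) p∣N)
    where
    p≡1+2h : 5 + 8 * t ≡ suc (2 * (suc (2 * t) + suc (2 * t)))
    p≡1+2h = arith t
      where
      arith : ∀ t → 5 + 8 * t ≡ suc (2 * (suc (2 * t) + suc (2 * t)))
      arith = solve-∀
  select (p , p-prime , p∣N , p∤2 , B≤p , p≢1 , ≡7mod8 t refl) =
    ⊥-elim (p∤x²+c {x = oddProduct B} p-prime p≡1+2h p∤2
      ([-2]^[r+m]≡-1 {r = suc (2 * t)} {m = suc (suc (2 * t))} {t = t} p-prime p≡1+2h refl (inj₂ refl)) p∣N)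
    where
    p≡1+2h : 7 + 8 * t ≡ suc (2 * (suc (2 * t) + suc (suc (2 * t))))
    p≡1+2h = arith t
      where
      arith : ∀ t → 7 + 8 * t ≡ suc (2 * (suc (2 * t) + suc (suc (2 * t))))
      arith = solve-∀

-- -4 is a non-residue modulo primes ≡ 3 (mod 4).
∃prime≡5mod8 : ∀ B → ∃[ p ] Prime p × B ≤ p × ∃[ t ] p ≡ 5 + 8 * t
∃prime≡5mod8 B = select (∃prime∣oddProduct²+2k∧≢1mod8 B 2 (inj₂ refl))
  where
  select : ∃[ p ] Prime p × p ∣ oddProduct B * oddProduct B + 4 × ¬ p ∣ 4 × B ≤ p × p % 8 ≢ 1 × OddResidueMod8 p →
           ∃[ p ] Prime p × B ≤ p × ∃[ t ] p ≡ 5 + 8 * t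
  select (p , p-prime , p∣N , p∤4 , B≤p , p≢1 , ≡1mod8 t refl) = ⊥-elim (p≢1 ([ρ+8t]%n≡ρ%n 1 t 8 ∣-refl))
  select (p , p-prime , p∣N , p∤4 , B≤p , p≢1 , ≡5mod8 t p≡)  = p , p-prime , B≤p , t , p≡
  select (p , p-prime , p∣N , p∤4 , B≤p , p≢1 , ≡3mod8 t refl) =
    ⊥-elim (p∤x²+c {x = oddProduct B} p-prime p≡1+2h p∤4 ([-4]^h≡-1 {t = 2 * t} p-prime p≡1+2h refl) p∣N)
    where
    p≡1+2h : 3 + 8 * t ≡ suc (2 * suc (2 * (2 * t)))
    p≡1+2h = arith t
      where
      arith : ∀ t → 3 + 8 * t ≡ suc (2 * suc (2 * (2 * t)))
      arith = solve-∀
  select (p , p-prime , p∣N , p∤4 , B≤p , p≢1 , ≡7mod8 t refl) =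
    ⊥-elim (p∤x²+c {x = oddProduct B} p-prime p≡1+2h p∤4 ([-4]^h≡-1 {t = 1 + 2 * t} p-prime p≡1+2h refl) p∣N)
    where
    p≡1+2h : 7 + 8 * t ≡ suc (2 * suc (2 * (1 + 2 * t)))
    p≡1+2h = arith t
      where
      arith : ∀ t → 7 + 8 * t ≡ suc (2 * suc (2 * (1 + 2 * t)))
      arith = solve-∀

-- The exponents r(G, 2)

IsR-intro : ∀ {f r} → EventuallyDiv f 2 r → (∀ B → ∃[ ℓ ] Prime ℓ × B ≤ ℓ × 2^ r ∥ f ℓ) → IsR f 2 r
IsR-intro div exact = div , λ (B , 2^[1+r]∣) →
  let ℓ , ℓ-prime , B≤ℓ , r∥ = exact B in ∥⇒∤ r∥ (2^[1+r]∣ ℓ ℓ-prime B≤ℓ)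

IsR-d! : ∀ d → IsR (λ _ → d !) 2 (v₂ (d !))
IsR-d! d = IsR-intro (0 , λ _ _ _ → ∥⇒∣ d!∥) λ B →
  let ℓ , ℓ-prime , B≤ℓ , _ = ∃prime≡3mod8 B in ℓ , ℓ-prime , B≤ℓ , d!∥
  where
  d!∥ : 2^ v₂ (d !) ∥ d !
  d!∥ = 2^v₂∥ (d !) {{d !≢0}}

IsR-GLℚ : ∀ n → IsR (λ ℓ → glOrder n ℓ) 2 (glExponent v₂[3^j∸1] n)
IsR-GLℚ n = IsR-intro (3 , divisible) λ B → exact (∃prime≡3mod8 B)
  where
  divisible : ∀ ℓ → Prime ℓ → 3 ≤ ℓ → 2 ^ glExponent v₂[3^j∸1] n ∣ glOrder n ℓ
  divisible ℓ ℓ-prime 3≤ℓ =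
    let s , ℓ≡1+2s = prime≥3⇒odd ℓ-prime 3≤ℓ
        T , [1+2s]²≡ = [1+2s]²≡1+8T s
        ℓ²≡1+8T = trans (cong (λ z → z * z) ℓ≡1+2s) [1+2s]²≡
    in 2^glExponent∣glOrder {w = v₂[3^j∸1]}
         (λ j → [ ≈⇒∣ , ≈⇒∣ ]′ (2^v₂[3^j∸1]≈q^j∸1 {s = s} {T = T} ℓ≡1+2s ℓ²≡1+8T j)) n
  exact : ∀ {B} → ∃[ ℓ ] Prime ℓ × B ≤ ℓ × ∃[ t ] ℓ ≡ 3 + 8 * t →
          ∃[ ℓ ] Prime ℓ × B ≤ ℓ × 2^ glExponent v₂[3^j∸1] n ∥ glOrder n ℓ
  exact (ℓ , ℓ-prime , B≤ℓ , t , refl) = ℓ , ℓ-prime , B≤ℓ ,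
    2^glExponent∥glOrder {w = v₂[3^j∸1]} {s = suc (2 * (2 * t))} (ℓ≡1+2s t)
      (λ j → [ ≈-odd⇒∥ (2 * t) , ≈-odd⇒∥ (3 * t + 4 * t * t) ]′
               (2^v₂[3^j∸1]≈q^j∸1 {s = suc (2 * (2 * t))} {T = suc (2 * (3 * t + 4 * t * t))} (ℓ≡1+2s t) (ℓ²≡1+8T t) j)) n
    where
    ℓ≡1+2s : ∀ t → 3 + 8 * t ≡ 1 + 2 * suc (2 * (2 * t))
    ℓ≡1+2s = solve-∀
    ℓ²≡1+8T : ∀ t → (3 + 8 * t) * (3 + 8 * t) ≡ 1 + 8 * suc (2 * (3 * t + 4 * t * t))
    ℓ²≡1+8T = solve-∀

IsR-GLℚi : ∀ g → IsR (λ ℓ → glOrder g (normQi ℓ)) 2 (glExponent v₂[5^j∸1] g)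
IsR-GLℚi g = IsR-intro (3 , divisible) λ B → exact (∃prime≡5mod8 B)
  where
  divisible : ∀ ℓ → Prime ℓ → 3 ≤ ℓ → 2 ^ glExponent v₂[5^j∸1] g ∣ glOrder g (normQi ℓ)
  divisible ℓ ℓ-prime 3≤ℓ =
    let s , ℓ≡1+2s = prime≥3⇒odd ℓ-prime 3≤ℓ
        u , q≡1+4u = normQi-odd≡1+4u {s = s} ℓ≡1+2s
    in 2^glExponent∣glOrder {w = v₂[5^j∸1]} (λ j → ≈⇒∣ (2^v₂[5^j∸1]≈q^j∸1 {s = u} q≡1+4u j)) g
  exact : ∀ {B} → ∃[ ℓ ] Prime ℓ × B ≤ ℓ × ∃[ t ] ℓ ≡ 5 + 8 * t →
          ∃[ ℓ ] Prime ℓ × B ≤ ℓ × 2^ glExponent v₂[5^j∸1] g ∥ glOrder g (normQi ℓ)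
  exact (ℓ , ℓ-prime , B≤ℓ , t , refl) = ℓ , ℓ-prime , B≤ℓ ,
    subst (λ q → 2^ glExponent v₂[5^j∸1] g ∥ glOrder g q) (sym (normQi[5+8t]≡5+8t t))
      (2^glExponent∥glOrder {w = v₂[5^j∸1]} {s = 2 + 4 * t} (q≡1+2s t)
         (λ j → ≈-odd⇒∥ t (2^v₂[5^j∸1]≈q^j∸1 {s = suc (2 * t)} (q≡1+4u t) j)) g)
    where
    q≡1+2s : ∀ t → 5 + 8 * t ≡ 1 + 2 * (2 + 4 * t)
    q≡1+2s = solve-∀
    q≡1+4u : ∀ t → 5 + 8 * t ≡ 1 + 4 * suc (2 * t)
    q≡1+4u = solve-∀

oddCount : ℕ → ℕ
oddCount m = sumBelow m (λ k → suc k % 2)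

glExponent-v₂[5^j∸1]≡2m+v₂[m!] : ∀ m → glExponent v₂[5^j∸1] m ≡ m * 2 + v₂ (m !)
glExponent-v₂[5^j∸1]≡2m+v₂[m!] m = begin
  sumBelow m (λ k → 2 + v₂ (suc k))                  ≡⟨ sumBelow-distrib-+ m ⟩
  sumBelow m (λ _ → 2) + sumBelow m (λ k → v₂ (suc k)) ≡⟨ cong₂ _+_ (sumBelow-const m 2) (sym (v₂[n!]≡Σv₂ m)) ⟩
  m * 2 + v₂ (m !)                                   ∎
  where open ≡-Reasoning

glExponent-v₂[5^j∸1]≡v₂[3^j∸1]+oddCount : ∀ m → glExponent v₂[5^j∸1] m ≡ glExponent v₂[3^j∸1] m + oddCount m
glExponent-v₂[5^j∸1]≡v₂[3^j∸1]+oddCount m =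
  trans (sumBelow-cong m λ k _ → v₂[5^j∸1]≡v₂[3^j∸1]+j%2 (suc k)) (sumBelow-distrib-+ m)

1≤oddCount : 1 ≤ m → 1 ≤ oddCount m
1≤oddCount = sumBelow-monoˡ-≤ (λ k → suc k % 2)

2≤oddCount : 3 ≤ m → 2 ≤ oddCount m
2≤oddCount = sumBelow-monoˡ-≤ (λ k → suc k % 2)

v₂[m!]-mono-≤ : m ≤ n → v₂ (m !) ≤ v₂ (n !)
v₂[m!]-mono-≤ {m} {n} m≤n =
  subst₂ _≤_ (sym (v₂[n!]≡Σv₂ m)) (sym (v₂[n!]≡Σv₂ n)) (sumBelow-monoˡ-≤ (λ k → v₂ (suc k)) m≤n)

exponent-inequality-d≡2 : 1 < n →
  glExponent v₂[3^j∸1] n + v₂ (2 !) ≤ glExponent v₂[5^j∸1] n ×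
  (glExponent v₂[5^j∸1] n ≡ glExponent v₂[3^j∸1] n + v₂ (2 !) → n ≡ 2)
exponent-inequality-d≡2 {n} 1<n = b+1≤a , equality
  where
  b = glExponent v₂[3^j∸1] n
  a≡b+oddCount = glExponent-v₂[5^j∸1]≡v₂[3^j∸1]+oddCount n
  v₂[2!]≡1 : v₂ (2 !) ≡ 1
  v₂[2!]≡1 = ∥⇒v₂≡ (0 , refl)
  b+1≤a : b + v₂ (2 !) ≤ glExponent v₂[5^j∸1] n
  b+1≤a = subst₂ (λ c a → b + c ≤ a) (sym v₂[2!]≡1) (sym a≡b+oddCount) (+-monoʳ-≤ b (1≤oddCount (<⇒≤ 1<n)))
  equality : glExponent v₂[5^j∸1] n ≡ b + v₂ (2 !) → n ≡ 2
  equality a≡b+1 = ≤-antisym (≮⇒≥ λ 2<n → <⇒≱ (s≤s ≤-refl) (subst (2 ≤_) oddCount≡1 (2≤oddCount 2<n))) 1<n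
    where
    oddCount≡1 : oddCount n ≡ 1
    oddCount≡1 = +-cancelˡ-≡ b _ _ (trans (sym a≡b+oddCount) (trans a≡b+1 (cong (λ c → b + c) v₂[2!]≡1)))

exponent-inequality-d≥3 : ∀ {d g} → 1 < n → 3 ≤ d → g * 2 ≡ d * n →
  glExponent v₂[3^j∸1] n + v₂ (d !) < glExponent v₂[5^j∸1] g
exponent-inequality-d≥3 {n} {d} {g} 1<n 3≤d g*2≡d*n = begin-strict
  glExponent v₂[3^j∸1] n + v₂ (d !)
    <⟨ +-monoˡ-< (v₂ (d !)) (subst (glExponent v₂[3^j∸1] n <_) (sym (glExponent-v₂[5^j∸1]≡v₂[3^j∸1]+oddCount n))
                                   (m<m+n _ (1≤oddCount (<⇒≤ 1<n)))) ⟩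
  glExponent v₂[5^j∸1] n + v₂ (d !)     ≡⟨ cong (_+ v₂ (d !)) (glExponent-v₂[5^j∸1]≡2m+v₂[m!] n) ⟩
  n * 2 + v₂ (n !) + v₂ (d !)           ≤⟨ +-mono-≤ (+-monoʳ-≤ (n * 2) (v₂[n!]≤n n)) (v₂[m!]-mono-≤ d≤g) ⟩
  n * 2 + n + v₂ (g !)                  ≤⟨ +-monoˡ-≤ (v₂ (g !)) (subst (_≤ d * n) (3n≡2n+n n) (*-monoˡ-≤ n 3≤d)) ⟩
  d * n + v₂ (g !)                      ≡⟨ cong (_+ v₂ (g !)) g*2≡d*n ⟨
  g * 2 + v₂ (g !)                      ≡⟨ glExponent-v₂[5^j∸1]≡2m+v₂[m!] g ⟨
  glExponent v₂[5^j∸1] g                ∎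
  where
  open ≤-Reasoning
  d≤g : d ≤ g
  d≤g = *-cancelʳ-≤ d g 2 (subst (d * 2 ≤_) (sym g*2≡d*n) (*-monoʳ-≤ d 1<n))
  3n≡2n+n : ∀ n → 3 * n ≡ n * 2 + n
  3n≡2n+n = solve-∀

exponent-inequality : ∀ {d g} → 1 < n → 1 < d → g * 2 ≡ d * n →
  glExponent v₂[3^j∸1] n + v₂ (d !) ≤ glExponent v₂[5^j∸1] g ×
  (glExponent v₂[5^j∸1] g ≡ glExponent v₂[3^j∸1] n + v₂ (d !) → n ≡ 2 × d ≡ 2)
exponent-inequality {n} {2} {g} 1<n _ g*2≡2*n with *-cancelʳ-≡ g n 2 (trans g*2≡2*n (*-comm 2 n))
... | refl = let b+1≤a , equality = exponent-inequality-d≡2 1<n in b+1≤a , λ a≡b+1 → equality a≡b+1 , refl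
exponent-inequality {d = 1} _ (s≤s ()) _
exponent-inequality {n} {d@(suc (suc (suc _)))} {g} 1<n _ g*2≡d*n =
  <⇒≤ b+c<a , λ a≡b+c → ⊥-elim (<⇒≢ b+c<a (sym a≡b+c))
  where
  b+c<a : glExponent v₂[3^j∸1] n + v₂ (d !) < glExponent v₂[5^j∸1] g
  b+c<a = exponent-inequality-d≥3 {d = d} {g = g} 1<n (s≤s (s≤s (s≤s z≤n))) g*2≡d*n

lemma4p6 : (n d : ℕ) → 1 < n → 1 < d → (g : ℕ) → g * 2 ≡ d * n →
    Σ ℕ λ a → Σ ℕ λ b → Σ ℕ λ c →
      IsR (λ ℓ → glOrder g (normQi ℓ)) 2 a
      × IsR (λ ℓ → glOrder n ℓ) 2 b
      × IsR (λ ℓ → d !) 2 c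
      × b + c ≤ a
      × (a ≡ b + c → n ≡ 2 × d ≡ 2)
lemma4p6 n d 1<n 1<d g g*2≡d*n =
  glExponent v₂[5^j∸1] g , glExponent v₂[3^j∸1] n , v₂ (d !) ,
  IsR-GLℚi g , IsR-GLℚ n , IsR-d! d , exponent-inequality {g = g} 1<n 1<d g*2≡d*n
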